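{- Let $G$ be a finite reflexive graph. If $G$ is a strong cocomparability graph, then $B(G)$ is a cocomparability bigraph.
   Context: A reflexive graph has a loop at every vertex; its adjacency matrix has 1's on the diagonal. A reflexive graph is a strong cocomparability graph if its adjacency matrix has a simultaneous row-and-column permutation containing no submatrix (rows $i<j$, columns $k<l$) equal to the Slash matrix $\begin{bmatrix}0&1\\1&0\end{bmatrix}$. $B(G)$ is the bipartite graph with colour classes $\{v':v\in V(G)\}$ and $\{v'':v\in V(G)\}$ and edge set $\{u'v'',u''v' : uv\in E(G)\}$ (so $v'v''$ is an edge for each $v$). A bigraph (bipartite graph with given colour classes $X,Y$) is a cocomparability bigraph if its biadjacency matrix (rows indexed by $X$, columns by $Y$) admits independent row and column permutations yielding a matrix not containing the Slash matrix as a submatrix. -}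

module Defs where

open import Data.Nat using (ℕ)
open import Data.Fin using (Fin; _<_)
open import Data.Fin.Permutation using (Permutation′; _⟨$⟩ʳ_)
open import Data.Bool using (Bool; true; false)
open import Data.Product using (Σ; _×_)
open import Relation.Binary.PropositionalEquality using (_≡_)
open import Relation.Nullary using (¬_)

Matrix : ℕ → ℕ → Set
Matrix m n = Fin m → Fin n → Bool

ContainsSlash : ∀ {m n} → Matrix m n → Set
ContainsSlash {m} {n} M =
  Σ (Fin m) λ i → Σ (Fin m) λ j → Σ (Fin n) λ k → Σ (Fin n) λ l →
    i < j × k < l ×
    M i k ≡ false × M i l ≡ true × M j k ≡ true × M j l ≡ false

SlashFree : ∀ {m n} → Matrix m n → Set
SlashFree M = ¬ ContainsSlash M

record Graph (n : ℕ) : Set where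
  field
    adj : Matrix n n
    sym : ∀ u v → adj u v ≡ adj v u

Reflexive : ∀ {n} → Graph n → Set
Reflexive {n} G = ∀ (v : Fin n) → Graph.adj G v v ≡ true

permuteSym : ∀ {n} → Permutation′ n → Matrix n n → Matrix n n
permuteSym π M i j = M (π ⟨$⟩ʳ i) (π ⟨$⟩ʳ j)

permuteRC : ∀ {m n} → Permutation′ m → Permutation′ n → Matrix m n → Matrix m n
permuteRC ρ σ M i j = M (ρ ⟨$⟩ʳ i) (σ ⟨$⟩ʳ j)

StrongCocomparability : ∀ {n} → Graph n → Set
StrongCocomparability {n} G =
  Σ (Permutation′ n) λ π → SlashFree (permuteSym π (Graph.adj G))

record Bigraph (m n : ℕ) : Set where
  field
    biadj : Matrix m n

CocomparabilityBigraph : ∀ {m n} → Bigraph m n → Set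
CocomparabilityBigraph {m} {n} H =
  Σ (Permutation′ m) λ ρ → Σ (Permutation′ n) λ σ →
    SlashFree (permuteRC ρ σ (Bigraph.biadj H))

-- B(G): colour classes {v'} (indexed by Fin n) and {v''} (indexed by Fin n);
-- u' v'' is an edge iff uv ∈ E(G) (loops included, so v' v'' always present
-- for reflexive G).
B : ∀ {n} → Graph n → Bigraph n n
B G = record { biadj = λ u v → Graph.adj G u v }

{-# OPTIONS --safe #-}
module Submission where

open import Data.Nat using (ℕ)
open import Data.Product using (_,_)
open import Defs

-- The biadjacency matrix of B G is the adjacency matrix of G, and a simultaneous
-- permutation is the special case ρ = σ of independent row and column permutations,
-- so permuteSym π adj and permuteRC π π adj coincide definitionally.
proposition10 : ∀ {n : ℕ} (G : Graph n) → Reflexive G →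
    StrongCocomparability G → CocomparabilityBigraph (B G)
proposition10 G _ (π , slashFree) = π , π , slashFree
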